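{- Let $\alpha\in K$ be a $k$-anxious root of unity and $m\ge1$ the least positive integer with $\alpha^{k^m}=\alpha$. Let $(c_i)_{i=1}^n$ be a sequence of rational functions, let $j_0\ge0$, and set $(\widetilde c_i)=(h_{\alpha^{k^{j_0}}})^*(c_i)$, where $h_\beta(z)=z-\beta$. Then for all $j\ge0$ and $1\le i\le n$, $$v_{\alpha^{k^j}}(\widetilde c_i)=v_{\alpha^{k^j}}(c_i)+\begin{cases}-1&\text{if } j\equiv j_0 \pmod m\text{ and } i\not\equiv j_0-j\pmod m,\\ 1&\text{if } i\equiv j_0-j\pmod m\text{ and } j\not\equiv j_0\pmod m,\\ 0&\text{otherwise.}\end{cases}$$
   Context: Throughout, $K$ is an algebraically closed field of characteristic $0$ or $p>0$, and $k\ge 2$ is an integer; if $\operatorname{char}K=p>0$ then $k$ is coprime to $p$. $v_\beta$ is the $(z-\beta)$-adic valuation on $K(z)$, with $v_\beta(0)=+\infty$ and $+\infty\pm1=+\infty$. A root of unity is $k$-anxious iff its order is coprime to $k$. For nonzero $h\in K(z)$, $h^*(c_i)=\bigl(\tfrac{h(z^{k^i})}{h(z)}c_i(z)\bigr)_{i=1}^n$. -}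

module Defs where

open import Level using (Level; _⊔_)
open import Algebra.Bundles using (CommutativeRing)
open import Data.Nat as ℕ using (ℕ; zero; suc; _≤_)
open import Data.Nat.Primality using (Prime)
open import Data.Nat.Coprimality using (Coprime)
open import Data.Integer as ℤ using (ℤ; +_)
open import Data.List using (List; []; _∷_; _++_; replicate)
open import Data.Product using (Σ; _×_; ∃)
open import Data.Sum using (_⊎_)
open import Relation.Nullary using (¬_)
open import Relation.Binary.PropositionalEquality using (_≡_)

-- Extended integers ℤ ∪ {+∞}, the value group of a valuation (v(0) = +∞).
data ℤ∞ : Set where
  fin : ℤ → ℤ∞
  ∞   : ℤ∞

_+∞_ : ℤ∞ → ℤ → ℤ∞
fin a +∞ d = fin (a ℤ.+ d)
∞     +∞ d = ∞

module _ {c ℓ : Level} (R : CommutativeRing c ℓ) where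
  open CommutativeRing R

  pow : Carrier → ℕ → Carrier
  pow x zero    = 1#
  pow x (suc n) = x * pow x n

  natCast : ℕ → Carrier
  natCast zero    = 0#
  natCast (suc n) = 1# + natCast n

  -- Polynomials in z with coefficients in the ring, as coefficient lists
  -- (lowest degree first); equality is coefficientwise (trailing zeros ignored).
  Poly : Set c
  Poly = List Carrier

  coeff : Poly → ℕ → Carrier
  coeff []       _       = 0#
  coeff (a ∷ as) zero    = a
  coeff (a ∷ as) (suc i) = coeff as i

  _≈ₚ_ : Poly → Poly → Set ℓ
  p ≈ₚ q = ∀ i → coeff p i ≈ coeff q i

  0ₚ : Poly
  0ₚ = []

  _+ₚ_ : Poly → Poly → Poly
  []       +ₚ q        = q
  (a ∷ as) +ₚ []       = a ∷ as
  (a ∷ as) +ₚ (b ∷ bs) = (a + b) ∷ (as +ₚ bs)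

  scaleₚ : Carrier → Poly → Poly
  scaleₚ a []       = []
  scaleₚ a (b ∷ bs) = (a * b) ∷ scaleₚ a bs

  _*ₚ_ : Poly → Poly → Poly
  []       *ₚ q = []
  (a ∷ as) *ₚ q = scaleₚ a q +ₚ (0# ∷ (as *ₚ q))

  powₚ : Poly → ℕ → Poly
  powₚ p zero    = 1# ∷ []
  powₚ p (suc n) = p *ₚ powₚ p n

  eval : Poly → Carrier → Carrier
  eval []       β = 0#
  eval (a ∷ as) β = a + β * eval as β

  hpoly : Carrier → Poly
  hpoly β = (- β) ∷ 1# ∷ []

  -- substitution p(z) ↦ p(z^N):  a + z·P(z) ↦ a + z^N · P(z^N)
  expand : ℕ → Poly → Poly
  expand N []       = []
  expand N (a ∷ as) = (a ∷ []) +ₚ (replicate N 0# ++ expand N as)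

  OrdFin : Carrier → Poly → ℕ → Set (c ⊔ ℓ)
  OrdFin β p n = Σ Poly (λ q → (p ≈ₚ (powₚ (hpoly β) n *ₚ q)) × ¬ (eval q β ≈ 0#))

  -- Rational functions in K(z) represented as fractions num/den
  -- (den ≠ 0 is required for the valuation to exist, see Val).
  record Frac : Set c where
    constructor _/_
    field
      num : Poly
      den : Poly
  open Frac public

  IsRatFun : Frac → Set ℓ
  IsRatFun f = ¬ (den f ≈ₚ 0ₚ)

  data Val (β : Carrier) (f : Frac) : ℤ∞ → Set (c ⊔ ℓ) where
    val-∞   : num f ≈ₚ 0ₚ → ¬ (den f ≈ₚ 0ₚ) → Val β f ∞
    val-fin : ∀ a b → OrdFin β (num f) a → OrdFin β (den f) b →
              Val β f (fin ((+ a) ℤ.- (+ b)))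

  -- h^*(c_i) = h(z^{k^i})/h(z) · c_i  for a polynomial h (here h = h_β)
  pullback : ℕ → Poly → ℕ → Frac → Frac
  pullback k h i f = (expand (k ℕ.^ i) h *ₚ num f) / (h *ₚ den f)

  record IsField : Set (c ⊔ ℓ) where
    field
      1≉0 : ¬ (1# ≈ 0#)
      inv : ∀ x → ¬ (x ≈ 0#) → Σ Carrier (λ y → x * y ≈ 1#)

  Nonconstant : Poly → Set ℓ
  Nonconstant p = Σ ℕ (λ i → ¬ (coeff p (suc i) ≈ 0#))

  IsAlgClosed : Set (c ⊔ ℓ)
  IsAlgClosed = ∀ p → Nonconstant p → Σ Carrier (λ β → eval p β ≈ 0#)

  CharZero : Set ℓ
  CharZero = ∀ n → natCast n ≈ 0# → n ≡ 0

  CharP : ℕ → Set ℓ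
  CharP p = Prime p × natCast p ≈ 0#

  CharAdmissible : ℕ → Set ℓ
  CharAdmissible k = CharZero ⊎ Σ ℕ (λ p → CharP p × Coprime k p)

  IsOrder : Carrier → ℕ → Set ℓ
  IsOrder α N = 1 ≤ N × pow α N ≈ 1# × (∀ M → 1 ≤ M → pow α M ≈ 1# → N ≤ M)

  KAnxious : ℕ → Carrier → Set ℓ
  KAnxious k α = Σ ℕ (λ N → IsOrder α N × Coprime N k)

  IsLeastReturn : ℕ → Carrier → ℕ → Set ℓ
  IsLeastReturn k α m =
    1 ≤ m × pow α (k ℕ.^ m) ≈ α × (∀ m' → 1 ≤ m' → pow α (k ℕ.^ m') ≈ α → m ≤ m')

-- The correction term in Lemma 10 for indices i (1 ≤ i ≤ n), j, j₀, period m: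
--   -1 if j ≡ j₀ and i ≢ j₀ - j (mod m);  +1 if i ≡ j₀ - j and j ≢ j₀ (mod m);  0 otherwise.
-- "i ≡ j₀ - j (mod m)" is expressed as (i + j) mod m = j₀ mod m.
open import Data.Nat.DivMod using (_%_)
open import Relation.Nullary using (yes; no)
open import Data.Nat using (_≟_; NonZero)

δ : (m : ℕ) .{{_ : NonZero m}} → ℕ → ℕ → ℕ → ℤ
δ m i j j₀ with (j % m) ≟ (j₀ % m) | ((i ℕ.+ j) % m) ≟ (j₀ % m)
... | yes _ | no _  = ℤ.-[1+ 0 ]
... | no _  | yes _ = + 1
... | _     | _     = + 0

-- The i-th pulled-back function is h_β(z^{k^i})/h_β(z) · c_i.  Over a field
-- orders of vanishing add under multiplication, so its valuation at γ is
-- v_γ(c_i) + ord_γ h_β(z^{k^i}) - ord_γ h_β(z)  (VanishingOrder); for v = +∞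
-- one only needs that z - β is not a zero divisor.  As h_β(z) = h_β(z^{k^0}),
-- both orders are one computation (OrbitVanishing): z^N - β vanishes simply at
-- γ if γ^N = β, since z^N - γ^N = (z - γ)·G with G(γ) = N γ^{N-1} ≠ 0 (k · 1 is
-- a unit by the assumption on char K), and not at all otherwise.  Finally
-- γ^{k^i} = α^{k^{i+j}} equals β iff i + j ≡ j₀ (mod m) (FrobeniusOrbit),
-- because z ↦ z^k is injective on roots of unity of order prime to k and m is
-- the least return time.  The difference of the two 0/1 orders is δ.
module Submission where

open import Algebra.Bundles using (CommutativeRing)
import Algebra.Properties.Group as GroupProperties
import Algebra.Properties.Ring as RingProperties
import Algebra.Solver.Ring.NaturalCoefficients.Default as NaturalSolver
open import Data.Empty using (⊥; ⊥-elim)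
open import Data.Fin using (Fin; toℕ)
open import Data.Integer as ℤ using (ℤ; +_)
import Data.Integer.Properties as ℤP
open import Data.Integer.Tactic.RingSolver using (solve-∀)
open import Data.List using ([]; _∷_; replicate; _++_; length)
open import Data.Nat as ℕ using (ℕ; zero; suc; _≤_; _<_; _^_; NonZero; s≤s; z≤n; _≟_)
open import Data.Nat.Coprimality using (Coprime; coprime-Bézout)
open import Data.Nat.DivMod using (_%_; m≡m%n+[m/n]*n; m%n<n; %-distribˡ-+; m%n%n≡m%n)
open import Data.Nat.GCD using (module Bézout)
import Data.Nat.Properties as ℕP
open import Data.Product using (_×_; _,_; proj₁; proj₂)
open import Data.Sum using (inj₁; inj₂)
open import Relation.Binary.Bundles using (Setoid)
open import Relation.Binary.PropositionalEquality as Eq using (_≡_)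
import Relation.Binary.Reasoning.Setoid as SetoidReasoning
open import Relation.Nullary using (¬_; Dec; yes; no)

open import Defs

module RingPowers {c ℓ} (K : CommutativeRing c ℓ) where
  open CommutativeRing K hiding (zero)
  open NaturalSolver commutativeSemiring using (solve; _:=_; _:*_)

  pw : Carrier → ℕ → Carrier
  pw = pow K

  cast : ℕ → Carrier
  cast = natCast K

  pw-cong : ∀ {x y} → x ≈ y → ∀ n → pw x n ≈ pw y n
  pw-cong e zero    = refl
  pw-cong e (suc n) = *-cong e (pw-cong e n)

  pw-one : ∀ n → pw 1# n ≈ 1#
  pw-one zero    = refl
  pw-one (suc n) = trans (*-identityˡ _) (pw-one n)

  pw-+ : ∀ x a b → pw x (a ℕ.+ b) ≈ pw x a * pw x b
  pw-+ x zero    b = sym (*-identityˡ _)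
  pw-+ x (suc a) b = trans (*-congˡ (pw-+ x a b)) (sym (*-assoc _ _ _))

  pw-distrib : ∀ x y n → pw (x * y) n ≈ pw x n * pw y n
  pw-distrib x y zero    = sym (*-identityˡ 1#)
  pw-distrib x y (suc n) = trans (*-congˡ (pw-distrib x y n))
    (solve 4 (λ x y a b → (x :* y) :* (a :* b) := (x :* a) :* (y :* b)) refl x y (pw x n) (pw y n))

  pw-* : ∀ x a b → pw x (a ℕ.* b) ≈ pw (pw x a) b
  pw-* x zero    b = sym (pw-one b)
  pw-* x (suc a) b =
    trans (pw-+ x b (a ℕ.* b)) (trans (*-congˡ (pw-* x a b)) (sym (pw-distrib x (pw x a) b)))

  cast-+ : ∀ a b → cast (a ℕ.+ b) ≈ cast a + cast b
  cast-+ zero    b = sym (+-identityˡ _)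
  cast-+ (suc a) b = trans (+-congˡ (cast-+ a b)) (sym (+-assoc _ _ _))

  cast-* : ∀ a b → cast (a ℕ.* b) ≈ cast a * cast b
  cast-* zero    b = sym (zeroˡ _)
  cast-* (suc a) b = trans (cast-+ b (a ℕ.* b))
    (trans (+-cong (sym (*-identityˡ _)) (cast-* a b)) (sym (distribʳ _ _ _)))

  cast-^ : ∀ k i → cast (k ℕ.^ i) ≈ pw (cast k) i
  cast-^ k zero    = +-identityʳ 1#
  cast-^ k (suc i) = trans (cast-* k (k ℕ.^ i)) (*-congˡ (cast-^ k i))

module PolynomialArithmetic {c ℓ} (K : CommutativeRing c ℓ) where
  open CommutativeRing K hiding (zero)
  open NaturalSolver commutativeSemiring using (solve; _:=_; _:+_; _:*_)

  Pol : Set c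
  Pol = Poly K

  _⊞_ _⊠_ : Pol → Pol → Pol
  _⊞_ = _+ₚ_ K
  _⊠_ = _*ₚ_ K
  infixl 6 _⊞_
  infixl 7 _⊠_

  scale : Carrier → Pol → Pol
  scale = scaleₚ K

  coef : Pol → ℕ → Carrier
  coef = coeff K

  ev : Pol → Carrier → Carrier
  ev = eval K

  -- Coefficientwise equality, wrapped in a record so that the two
  -- polynomials can be inferred from a proof of it.
  record _≋_ (p q : Pol) : Set ℓ where
    constructor by-coeff
    field at : _≈ₚ_ K p q
  open _≋_ public
  infix 4 _≋_

  ≋-refl : ∀ {p} → p ≋ p
  ≋-refl = by-coeff λ _ → refl

  ≋-sym : ∀ {p q} → p ≋ q → q ≋ p
  ≋-sym e = by-coeff λ i → sym (at e i)

  ≋-trans : ∀ {p q r} → p ≋ q → q ≋ r → p ≋ r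
  ≋-trans e f = by-coeff λ i → trans (at e i) (at f i)

  polySetoid : Setoid c ℓ
  polySetoid = record
    { Carrier = Pol ; _≈_ = _≋_
    ; isEquivalence = record { refl = ≋-refl ; sym = ≋-sym ; trans = ≋-trans } }

  module ≋-Reasoning = SetoidReasoning polySetoid

  coef-⊞ : ∀ p q i → coef (p ⊞ q) i ≈ coef p i + coef q i
  coef-⊞ []       q        i       = sym (+-identityˡ _)
  coef-⊞ (a ∷ as) []       i       = sym (+-identityʳ _)
  coef-⊞ (a ∷ as) (b ∷ bs) zero    = refl
  coef-⊞ (a ∷ as) (b ∷ bs) (suc i) = coef-⊞ as bs i

  coef-scale : ∀ a p i → coef (scale a p) i ≈ a * coef p i
  coef-scale a []       i       = sym (zeroʳ a)
  coef-scale a (b ∷ bs) zero    = refl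
  coef-scale a (b ∷ bs) (suc i) = coef-scale a bs i

  ∷-cong : ∀ {a b p q} → a ≈ b → p ≋ q → (a ∷ p) ≋ (b ∷ q)
  ∷-cong e f = by-coeff λ { zero → e ; (suc i) → at f i }

  ∷-head : ∀ {a b p q} → (a ∷ p) ≋ (b ∷ q) → a ≈ b
  ∷-head e = at e zero

  ∷-tail : ∀ {a b p q} → (a ∷ p) ≋ (b ∷ q) → p ≋ q
  ∷-tail e = by-coeff λ i → at e (suc i)

  ∷-zero : ∀ {a p} → a ≈ 0# → p ≋ [] → (a ∷ p) ≋ []
  ∷-zero e f = by-coeff λ { zero → e ; (suc i) → at f i }

  ∷-zero⁻¹ : ∀ {a p} → (a ∷ p) ≋ [] → a ≈ 0# × p ≋ []
  ∷-zero⁻¹ e = at e zero , by-coeff λ i → at e (suc i)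

  ⊞-cong : ∀ {p p' q q'} → p ≋ p' → q ≋ q' → p ⊞ q ≋ p' ⊞ q'
  ⊞-cong {p} {p'} {q} {q'} e f = by-coeff λ i →
    trans (coef-⊞ p q i) (trans (+-cong (at e i) (at f i)) (sym (coef-⊞ p' q' i)))

  ⊞-identityʳ : ∀ p → p ⊞ [] ≋ p
  ⊞-identityʳ []      = ≋-refl
  ⊞-identityʳ (a ∷ p) = ≋-refl

  ⊞-assoc : ∀ p q r → (p ⊞ q) ⊞ r ≋ p ⊞ (q ⊞ r)
  ⊞-assoc p q r = by-coeff λ i → begin
      coef ((p ⊞ q) ⊞ r) i         ≈⟨ trans (coef-⊞ (p ⊞ q) r i) (+-congʳ (coef-⊞ p q i)) ⟩
      (coef p i + coef q i) + coef r i ≈⟨ +-assoc _ _ _ ⟩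
      coef p i + (coef q i + coef r i) ≈⟨ sym (trans (coef-⊞ p (q ⊞ r) i) (+-congˡ (coef-⊞ q r i))) ⟩
      coef (p ⊞ (q ⊞ r)) i         ∎
    where open SetoidReasoning setoid

  ⊞-interchange : ∀ A B C D → (A ⊞ B) ⊞ (C ⊞ D) ≋ (A ⊞ C) ⊞ (B ⊞ D)
  ⊞-interchange A B C D = by-coeff λ i →
    trans (trans (coef-⊞ (A ⊞ B) (C ⊞ D) i) (+-cong (coef-⊞ A B i) (coef-⊞ C D i)))
    (trans (solve 4 (λ a b c d → (a :+ b) :+ (c :+ d) := (a :+ c) :+ (b :+ d)) refl
                    (coef A i) (coef B i) (coef C i) (coef D i))
           (sym (trans (coef-⊞ (A ⊞ C) (B ⊞ D) i) (+-cong (coef-⊞ A C i) (coef-⊞ B D i)))))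

  scale-cong : ∀ {a a' p p'} → a ≈ a' → p ≋ p' → scale a p ≋ scale a' p'
  scale-cong {a} {a'} {p} {p'} e f = by-coeff λ i →
    trans (coef-scale a p i) (trans (*-cong e (at f i)) (sym (coef-scale a' p' i)))

  scale-distribˡ : ∀ a p q → scale a (p ⊞ q) ≋ scale a p ⊞ scale a q
  scale-distribˡ a p q = by-coeff λ i →
    trans (coef-scale a (p ⊞ q) i) (trans (*-congˡ (coef-⊞ p q i))
    (trans (distribˡ _ _ _) (sym (trans (coef-⊞ (scale a p) (scale a q) i)
                                        (+-cong (coef-scale a p i) (coef-scale a q i))))))

  scale-distribʳ : ∀ a b p → scale (a + b) p ≋ scale a p ⊞ scale b p
  scale-distribʳ a b p = by-coeff λ i →
    trans (coef-scale (a + b) p i) (trans (distribʳ _ _ _)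
    (sym (trans (coef-⊞ (scale a p) (scale b p) i) (+-cong (coef-scale a p i) (coef-scale b p i)))))

  scale-assoc : ∀ a b p → scale a (scale b p) ≋ scale (a * b) p
  scale-assoc a b p = by-coeff λ i →
    trans (coef-scale a (scale b p) i) (trans (*-congˡ (coef-scale b p i))
    (trans (sym (*-assoc _ _ _)) (sym (coef-scale (a * b) p i))))

  scale-zero : ∀ p → scale 0# p ≋ []
  scale-zero p = by-coeff λ i → trans (coef-scale 0# p i) (zeroˡ _)

  scale-one : ∀ p → scale 1# p ≋ p
  scale-one p = by-coeff λ i → trans (coef-scale 1# p i) (*-identityˡ _)

  ⊠-zeroˡ : ∀ p q → p ≋ [] → p ⊠ q ≋ []
  ⊠-zeroˡ []       q e = ≋-refl
  ⊠-zeroˡ (a ∷ as) q e =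
    ⊞-cong (≋-trans (scale-cong (proj₁ (∷-zero⁻¹ e)) ≋-refl) (scale-zero q))
           (∷-zero refl (⊠-zeroˡ as q (proj₂ (∷-zero⁻¹ e))))

  ⊠-zeroʳ : ∀ q → q ⊠ [] ≋ []
  ⊠-zeroʳ []       = ≋-refl
  ⊠-zeroʳ (a ∷ as) = ∷-zero refl (⊠-zeroʳ as)

  ⊠-congˡ : ∀ {p p'} q → p ≋ p' → p ⊠ q ≋ p' ⊠ q
  ⊠-congˡ {[]}     {[]}     q e = ≋-refl
  ⊠-congˡ {[]}     {b ∷ bs} q e = ≋-sym (⊠-zeroˡ (b ∷ bs) q (≋-sym e))
  ⊠-congˡ {a ∷ as} {[]}     q e = ⊠-zeroˡ (a ∷ as) q e
  ⊠-congˡ {a ∷ as} {b ∷ bs} q e =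
    ⊞-cong (scale-cong (∷-head e) ≋-refl) (∷-cong refl (⊠-congˡ q (∷-tail e)))

  ⊠-congʳ : ∀ p {q q'} → q ≋ q' → p ⊠ q ≋ p ⊠ q'
  ⊠-congʳ []       e = ≋-refl
  ⊠-congʳ (a ∷ as) e = ⊞-cong (scale-cong refl e) (∷-cong refl (⊠-congʳ as e))

  ⊠-cong : ∀ {p p' q q'} → p ≋ p' → q ≋ q' → p ⊠ q ≋ p' ⊠ q'
  ⊠-cong {p' = p'} {q = q} e f = ≋-trans (⊠-congˡ q e) (⊠-congʳ p' f)

  shift-⊞ : ∀ X Y → (0# ∷ (X ⊞ Y)) ≋ (0# ∷ X) ⊞ (0# ∷ Y)
  shift-⊞ X Y = ∷-cong (sym (+-identityˡ 0#)) ≋-refl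

  ⊠-distribʳ : ∀ p q r → (p ⊞ q) ⊠ r ≋ p ⊠ r ⊞ q ⊠ r
  ⊠-distribʳ []       q        r = ≋-refl
  ⊠-distribʳ (a ∷ as) []       r = ≋-sym (⊞-identityʳ _)
  ⊠-distribʳ (a ∷ as) (b ∷ bs) r =
    ≋-trans (⊞-cong (scale-distribʳ a b r)
                    (≋-trans (∷-cong refl (⊠-distribʳ as bs r)) (shift-⊞ (as ⊠ r) (bs ⊠ r))))
            (⊞-interchange (scale a r) (scale b r) (0# ∷ (as ⊠ r)) (0# ∷ (bs ⊠ r)))

  ⊠-distribˡ : ∀ p q r → p ⊠ (q ⊞ r) ≋ p ⊠ q ⊞ p ⊠ r
  ⊠-distribˡ []       q r = ≋-refl
  ⊠-distribˡ (a ∷ as) q r =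
    ≋-trans (⊞-cong (scale-distribˡ a q r)
                    (≋-trans (∷-cong refl (⊠-distribˡ as q r)) (shift-⊞ (as ⊠ q) (as ⊠ r))))
            (⊞-interchange (scale a q) (scale a r) (0# ∷ (as ⊠ q)) (0# ∷ (as ⊠ r)))

  scale-⊠ : ∀ a p q → scale a p ⊠ q ≋ scale a (p ⊠ q)
  scale-⊠ a []       q = ≋-refl
  scale-⊠ a (b ∷ bs) q =
    ≋-trans (⊞-cong (≋-sym (scale-assoc a b q)) (∷-cong (sym (zeroʳ a)) (scale-⊠ a bs q)))
            (≋-sym (scale-distribˡ a (scale b q) (0# ∷ (bs ⊠ q))))

  ⊠-shiftʳ : ∀ p q → p ⊠ (0# ∷ q) ≋ (0# ∷ (p ⊠ q))
  ⊠-shiftʳ []       q = ≋-sym (∷-zero refl ≋-refl)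
  ⊠-shiftʳ (b ∷ bs) q = ∷-cong (trans (+-identityʳ _) (zeroʳ b)) (⊞-cong ≋-refl (⊠-shiftʳ bs q))

  ⊠-constant : ∀ q a → q ⊠ (a ∷ []) ≋ scale a q
  ⊠-constant []       a = ≋-refl
  ⊠-constant (b ∷ bs) a = ∷-cong (trans (+-identityʳ _) (*-comm b a)) (⊠-constant bs a)

  ⊠-identityˡ : ∀ q → (1# ∷ []) ⊠ q ≋ q
  ⊠-identityˡ q = by-coeff λ i →
    trans (coef-⊞ (scale 1# q) (0# ∷ []) i) (trans (+-cong (at (scale-one q) i) (zero-coef i)) (+-identityʳ _))
    where
    zero-coef : ∀ i → coef (0# ∷ []) i ≈ 0#
    zero-coef zero    = refl
    zero-coef (suc i) = refl

  ⊠-comm : ∀ p q → p ⊠ q ≋ q ⊠ p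
  ⊠-comm []       q = ≋-sym (⊠-zeroʳ q)
  ⊠-comm (a ∷ as) q = ≋-sym (begin
      q ⊠ (a ∷ as)                        ≈⟨ ⊠-congʳ q (∷-cong (sym (+-identityʳ a)) ≋-refl) ⟩
      q ⊠ ((a ∷ []) ⊞ (0# ∷ as))          ≈⟨ ⊠-distribˡ q (a ∷ []) (0# ∷ as) ⟩
      q ⊠ (a ∷ []) ⊞ q ⊠ (0# ∷ as)        ≈⟨ ⊞-cong (⊠-constant q a) (⊠-shiftʳ q as) ⟩
      scale a q ⊞ (0# ∷ (q ⊠ as))         ≈⟨ ⊞-cong ≋-refl (∷-cong refl (≋-sym (⊠-comm as q))) ⟩
      (a ∷ as) ⊠ q                        ∎)
    where open ≋-Reasoning

  ⊠-assoc : ∀ p q r → (p ⊠ q) ⊠ r ≋ p ⊠ (q ⊠ r)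
  ⊠-assoc []       q r = ≋-refl
  ⊠-assoc (a ∷ as) q r =
    ≋-trans (⊠-distribʳ (scale a q) (0# ∷ (as ⊠ q)) r)
            (⊞-cong (scale-⊠ a q r) (≋-trans (⊞-cong (scale-zero r) ≋-refl) (∷-cong refl (⊠-assoc as q r))))

  ⊠-interchange : ∀ X r Y q → (X ⊠ r) ⊠ (Y ⊠ q) ≋ (X ⊠ Y) ⊠ (r ⊠ q)
  ⊠-interchange X r Y q = begin
      (X ⊠ r) ⊠ (Y ⊠ q)   ≈⟨ ⊠-assoc X r (Y ⊠ q) ⟩
      X ⊠ (r ⊠ (Y ⊠ q))   ≈⟨ ⊠-congʳ X (≋-sym (⊠-assoc r Y q)) ⟩
      X ⊠ ((r ⊠ Y) ⊠ q)   ≈⟨ ⊠-congʳ X (⊠-congˡ q (⊠-comm r Y)) ⟩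
      X ⊠ ((Y ⊠ r) ⊠ q)   ≈⟨ ⊠-congʳ X (⊠-assoc Y r q) ⟩
      X ⊠ (Y ⊠ (r ⊠ q))   ≈⟨ ≋-sym (⊠-assoc X Y (r ⊠ q)) ⟩
      (X ⊠ Y) ⊠ (r ⊠ q)   ∎
    where open ≋-Reasoning

  polyPow : Pol → ℕ → Pol
  polyPow = powₚ K

  polyPow-+ : ∀ X e a → polyPow X e ⊠ polyPow X a ≋ polyPow X (e ℕ.+ a)
  polyPow-+ X zero    a = ⊠-identityˡ (polyPow X a)
  polyPow-+ X (suc e) a = ≋-trans (⊠-assoc X (polyPow X e) (polyPow X a)) (⊠-congʳ X (polyPow-+ X e a))

  ev-⊞ : ∀ p q β → ev (p ⊞ q) β ≈ ev p β + ev q β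
  ev-⊞ []       q        β = sym (+-identityˡ _)
  ev-⊞ (a ∷ as) []       β = sym (+-identityʳ _)
  ev-⊞ (a ∷ as) (b ∷ bs) β = trans (+-congˡ (*-congˡ (ev-⊞ as bs β)))
    (solve 5 (λ a b x y β → (a :+ b) :+ β :* (x :+ y) := (a :+ β :* x) :+ (b :+ β :* y)) refl
             a b (ev as β) (ev bs β) β)

  ev-scale : ∀ a p β → ev (scale a p) β ≈ a * ev p β
  ev-scale a []       β = sym (zeroʳ a)
  ev-scale a (b ∷ bs) β = trans (+-congˡ (*-congˡ (ev-scale a bs β)))
    (solve 4 (λ a b x β → a :* b :+ β :* (a :* x) := a :* (b :+ β :* x)) refl a b (ev bs β) β)

  ev-⊠ : ∀ p q β → ev (p ⊠ q) β ≈ ev p β * ev q β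
  ev-⊠ []       q β = sym (zeroˡ _)
  ev-⊠ (a ∷ as) q β =
    trans (ev-⊞ (scale a q) (0# ∷ (as ⊠ q)) β)
    (trans (+-cong (ev-scale a q β) (trans (+-identityˡ _) (*-congˡ (ev-⊠ as q β))))
    (solve 4 (λ a x y β → a :* y :+ β :* (x :* y) := (a :+ β :* x) :* y) refl a (ev as β) (ev q β) β))

  ev-zero : ∀ p β → p ≋ [] → ev p β ≈ 0#
  ev-zero []       β e = refl
  ev-zero (a ∷ as) β e =
    trans (+-cong (proj₁ (∷-zero⁻¹ e)) (*-congˡ (ev-zero as β (proj₂ (∷-zero⁻¹ e)))))
          (trans (+-identityˡ _) (zeroʳ β))

  ev-cong : ∀ {p q} β → p ≋ q → ev p β ≈ ev q β
  ev-cong {[]}     {[]}     β e = refl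
  ev-cong {[]}     {b ∷ bs} β e = sym (ev-zero (b ∷ bs) β (≋-sym e))
  ev-cong {a ∷ as} {[]}     β e = ev-zero (a ∷ as) β e
  ev-cong {a ∷ as} {b ∷ bs} β e = +-cong (∷-head e) (*-congˡ (ev-cong β (∷-tail e)))

module LinearFactors {c ℓ} (K : CommutativeRing c ℓ) where
  open CommutativeRing K hiding (zero)
  open NaturalSolver commutativeSemiring using (solve; _:=_; _:+_; _:*_; con)
  open RingProperties ring using (-‿distribˡ-*; -‿distribʳ-*; -‿involutive)
  open GroupProperties +-group using (inverseˡ-unique)
  open RingPowers K
  open PolynomialArithmetic K

  H : Carrier → Pol
  H = hpoly K

  -- z - β is not a zero divisor: from (z - β)·d = 0 the coefficients satisfy
  -- d_i = β d_{i+1}, hence d_i = β^t d_{i+t}, which vanishes for t = length d.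
  h-cancel : ∀ β d → H β ⊠ d ≋ [] → d ≋ []
  h-cancel β d e = by-coeff λ i →
    trans (unroll (length d) i) (trans (*-congˡ (reflexive (beyond d i))) (zeroʳ _))
    where
    e' : scale (- β) d ⊞ (0# ∷ d) ≋ []
    e' = ≋-trans (⊞-cong ≋-refl (∷-cong refl (≋-sym (⊠-identityˡ d)))) e
    step : ∀ i → coef d i ≈ β * coef d (suc i)
    step i = trans (inverseˡ-unique (coef d i) (- β * coef d (suc i))
               (trans (+-comm _ _) (trans (+-congʳ (sym (coef-scale (- β) d (suc i))))
                (trans (sym (coef-⊞ (scale (- β) d) (0# ∷ d) (suc i))) (at e' (suc i))))))
             (trans (-‿cong (sym (-‿distribˡ-* β (coef d (suc i))))) (-‿involutive _))
    unroll : ∀ t i → coef d i ≈ pw β t * coef d (t ℕ.+ i)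
    unroll zero    i = sym (*-identityˡ _)
    unroll (suc t) i = trans (step i) (trans (*-congˡ (unroll t (suc i)))
      (trans (sym (*-assoc β (pw β t) _)) (*-congˡ (reflexive (Eq.cong (coef d) (ℕP.+-suc t i))))))
    beyond : ∀ p i → coef p (length p ℕ.+ i) ≡ 0#
    beyond []       i = Eq.refl
    beyond (a ∷ as) i = beyond as i

  monomial : ℕ → Pol
  monomial N = replicate N 0# ++ (1# ∷ [])

  ev-monomial : ∀ N γ → ev (monomial N) γ ≈ pw γ N
  ev-monomial zero    γ = trans (+-congˡ (zeroʳ γ)) (+-identityʳ _)
  ev-monomial (suc N) γ = trans (+-identityˡ _) (*-congˡ (ev-monomial N γ))

  expand-constant : ∀ N a → expand K N (a ∷ []) ≋ (a ∷ [])
  expand-constant N a = by-coeff λ i →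
    trans (coef-⊞ (a ∷ []) (replicate N 0# ++ []) i) (trans (+-congˡ (padding N i)) (+-identityʳ _))
    where
    padding : ∀ N i → coef (replicate N 0# ++ []) i ≈ 0#
    padding zero    i       = refl
    padding (suc N) zero    = refl
    padding (suc N) (suc i) = padding N i

  expand-one : ∀ p → expand K 1 p ≋ p
  expand-one []       = ≋-refl
  expand-one (a ∷ as) = ∷-cong (+-identityʳ a) (expand-one as)

  expand-h : ∀ N β → expand K N (H β) ≋ ((- β) ∷ []) ⊞ monomial N
  expand-h N β = ⊞-cong ≋-refl (shifted N)
    where
    shifted : ∀ M → replicate M 0# ++ expand K N (1# ∷ []) ≋ monomial M
    shifted zero    = expand-constant N 1#
    shifted (suc M) = ∷-cong refl (shifted M)

  ev-expand-h : ∀ N β γ → ev (expand K N (H β)) γ ≈ (- β) + pw γ N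
  ev-expand-h N β γ = trans (ev-cong γ (expand-h N β)) (trans (ev-⊞ ((- β) ∷ []) (monomial N) γ)
    (+-cong (trans (+-congˡ (zeroʳ γ)) (+-identityʳ _)) (ev-monomial N γ)))

  geometric : Carrier → ℕ → Pol
  geometric γ zero    = []
  geometric γ (suc n) = pw γ n ∷ geometric γ n

  geometric-factor : ∀ γ n → H γ ⊠ geometric γ n ≋ ((- pw γ n) ∷ []) ⊞ monomial n
  geometric-factor γ zero    = ≋-trans (⊠-zeroʳ (H γ)) (≋-sym (∷-zero (-‿inverseˡ 1#) ≋-refl))
  geometric-factor γ (suc n) = begin
      H γ ⊠ (a ∷ g)                                   ≈⟨ ⊠-comm (H γ) (a ∷ g) ⟩
      scale a (H γ) ⊞ (0# ∷ g ⊠ H γ)                  ≈⟨ ⊞-cong {scale a (H γ)} ≋-refl (∷-cong refl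
                                                           (≋-trans (⊠-comm g (H γ)) (geometric-factor γ n))) ⟩
      scale a (H γ) ⊞ (0# ∷ ((- a) ∷ []) ⊞ monomial n) ≈⟨ ∷-cong (+-congʳ leading) cancel ⟩
      ((- pw γ (suc n)) ∷ []) ⊞ monomial (suc n)       ∎
    where
    open ≋-Reasoning
    a : Carrier
    a = pw γ n
    g : Pol
    g = geometric γ n
    leading : a * - γ ≈ - (γ * a)
    leading = trans (sym (-‿distribʳ-* a γ)) (-‿cong (*-comm a γ))
    cancel : ((a * 1#) ∷ []) ⊞ (((- a) ∷ []) ⊞ monomial n) ≋ monomial n
    cancel = ≋-trans (≋-sym (⊞-assoc ((a * 1#) ∷ []) ((- a) ∷ []) (monomial n)))
               (⊞-cong (∷-zero (trans (+-congʳ (*-identityʳ a)) (-‿inverseʳ a)) ≋-refl) ≋-refl)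

  ev-geometric : ∀ γ n → ev (geometric γ (suc n)) γ ≈ cast (suc n) * pw γ n
  ev-geometric γ zero    = trans (+-congˡ (zeroʳ γ))
    (trans (+-identityʳ 1#) (sym (trans (*-identityʳ _) (+-identityʳ 1#))))
  ev-geometric γ (suc n) = trans (+-congˡ (*-congˡ (ev-geometric γ n)))
    (solve 3 (λ g x c → g :* x :+ g :* (c :* x) := (con 1 :+ c) :* (g :* x)) refl γ (pw γ n) (cast (suc n)))

module VanishingOrder {c ℓ} (K : CommutativeRing c ℓ) (F : IsField K) where
  open CommutativeRing K hiding (zero)
  open IsField F
  open GroupProperties +-group using (inverseˡ-unique)
  open RingProperties ring using (-‿involutive)
  open RingPowers K
  open PolynomialArithmetic K
  open LinearFactors K

  nonzero-* : ∀ {x y} → ¬ x ≈ 0# → ¬ y ≈ 0# → ¬ x * y ≈ 0#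
  nonzero-* {x} {y} x≉0 y≉0 xy≈0 with inv x x≉0
  ... | x⁻¹ , xx⁻¹≈1 = y≉0 (begin
      y               ≈⟨ sym (*-identityˡ y) ⟩
      1# * y          ≈⟨ *-congʳ (trans (sym xx⁻¹≈1) (*-comm x x⁻¹)) ⟩
      (x⁻¹ * x) * y   ≈⟨ *-assoc x⁻¹ x y ⟩
      x⁻¹ * (x * y)   ≈⟨ *-congˡ xy≈0 ⟩
      x⁻¹ * 0#        ≈⟨ zeroʳ x⁻¹ ⟩
      0#              ∎)
    where open SetoidReasoning setoid

  pw-nonzero : ∀ {x} n → ¬ x ≈ 0# → ¬ pw x n ≈ 0#
  pw-nonzero zero    x≉0 = 1≉0
  pw-nonzero (suc n) x≉0 = nonzero-* x≉0 (pw-nonzero n x≉0)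

  OrdFin-cong : ∀ {γ p p' e} → p ≋ p' → OrdFin K γ p e → OrdFin K γ p' e
  OrdFin-cong {γ} {p} {e = e} p≋p' (r , p≈ , r≉0) =
    r , at (≋-trans (≋-sym p≋p') (by-coeff {p} {polyPow (H γ) e ⊠ r} p≈)) , r≉0

  order-zero : ∀ {γ p} → ¬ ev p γ ≈ 0# → OrdFin K γ p 0
  order-zero {p = p} p≉0 = p , at (≋-sym (⊠-identityˡ p)) , p≉0

  order-one : ∀ {γ p} r → p ≋ H γ ⊠ r → ¬ ev r γ ≈ 0# → OrdFin K γ p 1
  order-one {γ} r p≋ r≉0 =
    r , at (≋-trans p≋ (⊠-congˡ r (≋-sym (≋-trans (⊠-constant (H γ) 1#) (scale-one (H γ)))))) , r≉0

  order-* : ∀ {γ E p e a} → OrdFin K γ E e → OrdFin K γ p a → OrdFin K γ (E ⊠ p) (e ℕ.+ a)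
  order-* {γ} {E} {p} {e} {a} (r , E≈ , r≉0) (q , p≈ , q≉0) =
    r ⊠ q ,
    at (begin
      E ⊠ p                                      ≈⟨ ⊠-cong (by-coeff {E} {polyPow (H γ) e ⊠ r} E≈) (by-coeff {p} {polyPow (H γ) a ⊠ q} p≈) ⟩
      (polyPow (H γ) e ⊠ r) ⊠ (polyPow (H γ) a ⊠ q) ≈⟨ ⊠-interchange (polyPow (H γ) e) r (polyPow (H γ) a) q ⟩
      (polyPow (H γ) e ⊠ polyPow (H γ) a) ⊠ (r ⊠ q) ≈⟨ ⊠-congˡ (r ⊠ q) (polyPow-+ (H γ) e a) ⟩
      polyPow (H γ) (e ℕ.+ a) ⊠ (r ⊠ q)          ∎) ,
    λ rq≈0 → nonzero-* r≉0 q≉0 (trans (sym (ev-⊠ r q γ)) rq≈0)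
    where open ≋-Reasoning

  order-simple-root : ∀ N γ β → 1 ℕ.≤ N → pw γ N ≈ β → ¬ cast N ≈ 0# → ¬ γ ≈ 0# →
                      OrdFin K γ (expand K N (H β)) 1
  order-simple-root (suc M) γ β _ γᴺ≈β N≉0 γ≉0 = order-one {γ} {expand K (suc M) (H β)} (geometric γ (suc M))
    (≋-trans (expand-h (suc M) β) (≋-trans
      (⊞-cong {(- β) ∷ []} {(- pw γ (suc M)) ∷ []} {monomial (suc M)} (∷-cong (-‿cong (sym γᴺ≈β)) ≋-refl) ≋-refl)
      (≋-sym (geometric-factor γ (suc M)))))
    (λ G≈0 → nonzero-* N≉0 (pw-nonzero M γ≉0) (trans (sym (ev-geometric γ M)) G≈0))

  order-non-root : ∀ N γ β → ¬ pw γ N ≈ β → OrdFin K γ (expand K N (H β)) 0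
  order-non-root N γ β γᴺ≉β = order-zero {γ} {expand K N (H β)} λ ev≈0 → γᴺ≉β (begin
      pw γ N              ≈⟨ inverseˡ-unique (pw γ N) (- β) (trans (+-comm _ _) (trans (sym (ev-expand-h N β γ)) ev≈0)) ⟩
      - - β               ≈⟨ -‿involutive β ⟩
      β                   ∎)
    where open SetoidReasoning setoid

  difference-shift : ∀ a b e e' → (+ (e ℕ.+ a)) ℤ.- (+ (e' ℕ.+ b)) ≡ ((+ a) ℤ.- (+ b)) ℤ.+ ((+ e) ℤ.- (+ e'))
  difference-shift a b e e' rewrite ℤP.pos-+ e a | ℤP.pos-+ e' b = rearrange (+ a) (+ b) (+ e) (+ e')
    where
    rearrange : ∀ (a b e e' : ℤ) → (e ℤ.+ a) ℤ.- (e' ℤ.+ b) ≡ (a ℤ.- b) ℤ.+ (e ℤ.- e')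
    rearrange = solve-∀

  pullback-valuation : ∀ k i γ β f e e' {w} →
    OrdFin K γ (expand K (k ℕ.^ i) (H β)) e → OrdFin K γ (H β) e' → Val K γ f w →
    Val K γ (pullback K k (H β) i f) (w +∞ ((+ e) ℤ.- (+ e')))
  pullback-valuation k i γ β f _ _ _ _ (val-∞ num≈0 den≉0) =
    val-∞ (at (≋-trans (⊠-congʳ E (by-coeff {num f} {[]} num≈0)) (⊠-zeroʳ E)))
          (λ den'≈0 → den≉0 (at (h-cancel β (den f) (by-coeff den'≈0))))
    where
    E : Pol
    E = expand K (k ℕ.^ i) (H β)
  pullback-valuation k i γ β f e e' ordE ordH (val-fin a b ord-num ord-den) =
    Eq.subst (Val K γ (pullback K k (H β) i f)) (Eq.cong fin (difference-shift a b e e'))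
      (val-fin (e ℕ.+ a) (e' ℕ.+ b) (order-* {γ} {E} {num f} {e} {a} ordE ord-num)
                                    (order-* {γ} {H β} {den f} {e'} {b} ordH ord-den))
    where
    E : Pol
    E = expand K (k ℕ.^ i) (H β)

module RootsOfUnity {c ℓ} (K : CommutativeRing c ℓ) where
  open CommutativeRing K hiding (zero)
  open RingPowers K
  open SetoidReasoning setoid

  pw-multiple-of-order : ∀ {z} N x → pw z N ≈ 1# → pw z (x ℕ.* N) ≈ 1#
  pw-multiple-of-order {z} N x zᴺ≈1 = begin
    pw z (x ℕ.* N)   ≡⟨ Eq.cong (pw z) (ℕP.*-comm x N) ⟩
    pw z (N ℕ.* x)   ≈⟨ pw-* z N x ⟩
    pw (pw z N) x    ≈⟨ pw-cong zᴺ≈1 x ⟩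
    pw 1# x          ≈⟨ pw-one x ⟩
    1#               ∎

  pw-after-pw : ∀ z k y → pw z (y ℕ.* k) ≈ pw (pw z k) y
  pw-after-pw z k y = trans (reflexive (Eq.cong (pw z) (ℕP.*-comm y k))) (pw-* z k y)

  -- Bézout gives x, y with 1 + y·k = x·N or 1 + x·N = y·k; accordingly
  -- (z^k)^y is the inverse of z, or z itself, for every N-th root of unity z.
  frobenius-injective : ∀ N k → Coprime N k → ∀ {z w} → pw z N ≈ 1# → pw w N ≈ 1# →
                        pw z k ≈ pw w k → z ≈ w
  frobenius-injective N k coprime {z} {w} zᴺ≈1 wᴺ≈1 zᵏ≈wᵏ with coprime-Bézout coprime
  ... | Bézout.-+ x y 1+xN≡yk = begin
      z               ≈⟨ recover zᴺ≈1 ⟨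
      pw (pw z k) y   ≈⟨ pw-cong zᵏ≈wᵏ y ⟩
      pw (pw w k) y   ≈⟨ recover wᴺ≈1 ⟩
      w               ∎
    where
    recover : ∀ {u} → pw u N ≈ 1# → pw (pw u k) y ≈ u
    recover {u} uᴺ≈1 = begin
      pw (pw u k) y            ≈⟨ pw-after-pw u k y ⟨
      pw u (y ℕ.* k)           ≡⟨ Eq.cong (pw u) 1+xN≡yk ⟨
      u * pw u (x ℕ.* N)       ≈⟨ *-congˡ (pw-multiple-of-order N x uᴺ≈1) ⟩
      u * 1#                   ≈⟨ *-identityʳ u ⟩
      u                        ∎
  ... | Bézout.+- x y 1+yk≡xN = begin
      z               ≈⟨ *-identityʳ z ⟨
      z * 1#          ≈⟨ *-congˡ (inverse wᴺ≈1) ⟨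
      z * (w * t)     ≈⟨ *-congˡ (*-comm w t) ⟩
      z * (t * w)     ≈⟨ *-assoc z t w ⟨
      (z * t) * w     ≈⟨ *-congʳ (trans (*-congˡ (pw-cong (sym zᵏ≈wᵏ) y)) (inverse zᴺ≈1)) ⟩
      1# * w          ≈⟨ *-identityˡ w ⟩
      w               ∎
    where
    t : Carrier
    t = pw (pw w k) y
    inverse : ∀ {u} → pw u N ≈ 1# → u * pw (pw u k) y ≈ 1#
    inverse {u} uᴺ≈1 = begin
      u * pw (pw u k) y   ≈⟨ *-congˡ (pw-after-pw u k y) ⟨
      u * pw u (y ℕ.* k)  ≡⟨ Eq.cong (pw u) 1+yk≡xN ⟩
      pw u (x ℕ.* N)      ≈⟨ pw-multiple-of-order N x uᴺ≈1 ⟩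
      1#                  ∎

  root-of-unity-nonzero : ¬ 1# ≈ 0# → ∀ {z} N → 1 ≤ N → pw z N ≈ 1# → ¬ z ≈ 0#
  root-of-unity-nonzero 1≉0 {z} (suc N) _ zᴺ≈1 z≈0 =
    1≉0 (trans (sym zᴺ≈1) (trans (*-congʳ z≈0) (zeroˡ _)))

module FrobeniusOrbit {c ℓ} (K : CommutativeRing c ℓ) (k : ℕ) (α : CommutativeRing.Carrier K)
                      (anxious : KAnxious K k α)
                      (m : ℕ) .{{_ : NonZero m}} (least-return : IsLeastReturn K k α m) where
  open CommutativeRing K hiding (zero)
  open RingPowers K
  open RootsOfUnity K
  open SetoidReasoning setoid

  orbit : ℕ → Carrier
  orbit a = pw α (k ^ a)

  orbit-cong : ∀ {a b} → a ≡ b → orbit a ≈ orbit b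
  orbit-cong a≡b = reflexive (Eq.cong orbit a≡b)

  N : ℕ
  N = proj₁ anxious

  orbit-root-of-unity : ∀ a → pw (orbit a) N ≈ 1#
  orbit-root-of-unity a = begin
    pw (pw α (k ^ a)) N    ≈⟨ pw-* α (k ^ a) N ⟨
    pw α (k ^ a ℕ.* N)     ≈⟨ pw-multiple-of-order N (k ^ a) (proj₁ (proj₂ (proj₁ (proj₂ anxious)))) ⟩
    1#                     ∎

  orbit-step : ∀ a → orbit (suc a) ≈ pw (orbit a) k
  orbit-step a = pw-after-pw α (k ^ a) k

  -- Frobenius is injective on the orbit, so equal points stay equal when
  -- followed backwards: α^{k^x} = α^{k^{x+d}} implies α = α^{k^d}.
  orbit-cancel : ∀ x d → orbit x ≈ orbit (x ℕ.+ d) → orbit 0 ≈ orbit d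
  orbit-cancel zero    d eq = eq
  orbit-cancel (suc x) d eq = orbit-cancel x d
    (frobenius-injective N k (proj₂ (proj₂ anxious))
      (orbit-root-of-unity x) (orbit-root-of-unity (x ℕ.+ d))
      (trans (sym (orbit-step x)) (trans eq (orbit-step (x ℕ.+ d)))))

  orbit-period : ∀ x → orbit (m ℕ.+ x) ≈ orbit x
  orbit-period x = begin
    pw α (k ^ (m ℕ.+ x))      ≡⟨ Eq.cong (pw α) (ℕP.^-distribˡ-+-* k m x) ⟩
    pw α (k ^ m ℕ.* k ^ x)    ≈⟨ pw-* α (k ^ m) (k ^ x) ⟩
    pw (pw α (k ^ m)) (k ^ x) ≈⟨ pw-cong (proj₁ (proj₂ least-return)) (k ^ x) ⟩
    pw α (k ^ x)              ∎

  orbit-mod : ∀ a → orbit a ≈ orbit (a % m)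
  orbit-mod a = trans (orbit-cong (Eq.trans (m≡m%n+[m/n]*n a m) (ℕP.+-comm (a % m) ((a ℕ./ m) ℕ.* m))))
                      (periodic (a ℕ./ m) (a % m))
    where
    periodic : ∀ q x → orbit (q ℕ.* m ℕ.+ x) ≈ orbit x
    periodic zero    x = refl
    periodic (suc q) x = trans (orbit-cong (ℕP.+-assoc m (q ℕ.* m) x))
                               (trans (orbit-period (q ℕ.* m ℕ.+ x)) (periodic q x))

  orbit-pw : ∀ i j → pw (orbit j) (k ^ i) ≈ orbit (i ℕ.+ j)
  orbit-pw i j = begin
    pw (pw α (k ^ j)) (k ^ i)   ≈⟨ pw-* α (k ^ j) (k ^ i) ⟨
    pw α (k ^ j ℕ.* k ^ i)      ≡⟨ Eq.cong (pw α) (ℕP.^-distribˡ-+-* k j i) ⟨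
    pw α (k ^ (j ℕ.+ i))        ≡⟨ Eq.cong (λ e → pw α (k ^ e)) (ℕP.+-comm j i) ⟩
    pw α (k ^ (i ℕ.+ j))        ∎

  orbit-0 : orbit 0 ≈ α
  orbit-0 = *-identityʳ α

  return-time-divisible : ∀ d → orbit d ≈ α → d % m ≡ 0
  return-time-divisible d returns with d % m in eq
  ... | zero  = Eq.refl
  ... | suc r = ⊥-elim (ℕP.<-irrefl Eq.refl (ℕP.<-≤-trans (Eq.subst (_< m) eq (m%n<n d m))
                  (proj₂ (proj₂ least-return) (suc r) (s≤s z≤n)
                    (trans (sym (trans (orbit-mod d) (orbit-cong eq))) returns))))

  orbit-periodic : ∀ a b → a % m ≡ b % m → orbit a ≈ orbit b
  orbit-periodic a b eq = trans (orbit-mod a) (trans (orbit-cong eq) (sym (orbit-mod b)))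

  -- If α^{k^a} = α^{k^b} with a ≤ b, then b - a is a return time.
  orbit-injective-≤ : ∀ {a b} → a ≤ b → orbit a ≈ orbit b → a % m ≡ b % m
  orbit-injective-≤ {a} {b} a≤b eq = Eq.trans (Eq.sym (shift-mod (b ℕ.∸ a) divisible)) (Eq.cong (_% m) a+d≡b)
    where
    a+d≡b : a ℕ.+ (b ℕ.∸ a) ≡ b
    a+d≡b = ℕP.m+[n∸m]≡n a≤b
    divisible : (b ℕ.∸ a) % m ≡ 0
    divisible = return-time-divisible (b ℕ.∸ a)
      (trans (sym (orbit-cancel a (b ℕ.∸ a) (trans eq (orbit-cong (Eq.sym a+d≡b))))) orbit-0)
    shift-mod : ∀ d → d % m ≡ 0 → (a ℕ.+ d) % m ≡ a % m
    shift-mod d d%m≡0 = Eq.trans (%-distribˡ-+ a d m)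
      (Eq.trans (Eq.cong (λ t → (a % m ℕ.+ t) % m) d%m≡0)
      (Eq.trans (Eq.cong (_% m) (ℕP.+-identityʳ (a % m))) (m%n%n≡m%n a m)))

  orbit-injective : ∀ a b → orbit a ≈ orbit b → a % m ≡ b % m
  orbit-injective a b eq with ℕP.≤-total a b
  ... | inj₁ a≤b = orbit-injective-≤ a≤b eq
  ... | inj₂ b≤a = Eq.sym (orbit-injective-≤ b≤a (sym eq))

module Characteristic {c ℓ} (K : CommutativeRing c ℓ) (F : IsField K) where
  open CommutativeRing K hiding (zero)
  open IsField F
  open RingPowers K
  open VanishingOrder K F using (pw-nonzero)

  bezout-absurd : ∀ {a b} x y → 1 ℕ.+ y ℕ.* a ≡ x ℕ.* b → cast a ≈ 0# → cast b ≈ 0# → ⊥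
  bezout-absurd {a} {b} x y eq a≈0 b≈0 = 1≉0 (begin
    1#                        ≈⟨ +-identityʳ 1# ⟨
    1# + 0#                   ≈⟨ +-congˡ (trans (*-congˡ a≈0) (zeroʳ _)) ⟨
    1# + cast y * cast a      ≈⟨ +-congˡ (cast-* y a) ⟨
    cast (1 ℕ.+ y ℕ.* a)      ≡⟨ Eq.cong cast eq ⟩
    cast (x ℕ.* b)            ≈⟨ cast-* x b ⟩
    cast x * cast b           ≈⟨ trans (*-congˡ b≈0) (zeroʳ _) ⟩
    0#                        ∎)
    where open SetoidReasoning setoid

  coprime-to-characteristic : ∀ {k p} → cast p ≈ 0# → Coprime k p → ¬ cast k ≈ 0#
  coprime-to-characteristic p≈0 coprime k≈0 with coprime-Bézout coprime
  ... | Bézout.+- x y 1+yp≡xk = bezout-absurd x y 1+yp≡xk p≈0 k≈0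
  ... | Bézout.-+ x y 1+xk≡yp = bezout-absurd y x 1+xk≡yp k≈0 p≈0

  cast-nonzero : ∀ k → 2 ≤ k → CharAdmissible K k → ¬ cast k ≈ 0#
  cast-nonzero k 2≤k (inj₁ char-zero) k≈0 with char-zero k k≈0
  cast-nonzero .0 () (inj₁ char-zero) k≈0 | Eq.refl
  cast-nonzero k 2≤k (inj₂ (p , (_ , p≈0) , coprime)) = coprime-to-characteristic p≈0 coprime

  cast-pow-nonzero : ∀ k i → ¬ cast k ≈ 0# → ¬ cast (k ^ i) ≈ 0#
  cast-pow-nonzero k i k≉0 kⁱ≈0 = pw-nonzero i k≉0 (trans (sym (cast-^ k i)) kⁱ≈0)

indicator : ∀ {p} {P : Set p} → Dec P → ℕ
indicator (yes _) = 1
indicator (no _)  = 0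

δ-as-difference : ∀ m .{{_ : NonZero m}} i j j₀ →
  δ m i j j₀ ≡ (+ indicator ((i ℕ.+ j) % m ≟ j₀ % m)) ℤ.- (+ indicator (j % m ≟ j₀ % m))
δ-as-difference m i j j₀ with j % m ≟ j₀ % m | (i ℕ.+ j) % m ≟ j₀ % m
... | yes _ | yes _ = Eq.refl
... | yes _ | no  _ = Eq.refl
... | no  _ | yes _ = Eq.refl
... | no  _ | no  _ = Eq.refl

module OrbitVanishing {c ℓ} (K : CommutativeRing c ℓ) (F : IsField K)
                      (k : ℕ) (2≤k : 2 ≤ k) (char : CharAdmissible K k)
                      (α : CommutativeRing.Carrier K) (anxious : KAnxious K k α)
                      (m : ℕ) .{{_ : NonZero m}} (least-return : IsLeastReturn K k α m) where
  open CommutativeRing K hiding (zero)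
  open IsField F
  open LinearFactors K using (H)
  open VanishingOrder K F using (order-simple-root; order-non-root)
  open RootsOfUnity K using (root-of-unity-nonzero)
  open Characteristic K F using (cast-nonzero; cast-pow-nonzero)
  open FrobeniusOrbit K k α anxious m least-return

  orbit-nonzero : ∀ j → ¬ orbit j ≈ 0#
  orbit-nonzero j = root-of-unity-nonzero 1≉0 N (proj₁ (proj₁ (proj₂ anxious))) (orbit-root-of-unity j)

  order-on-orbit : ∀ i j₀ j (d : Dec ((i ℕ.+ j) % m ≡ j₀ % m)) →
                   OrdFin K (orbit j) (expand K (k ^ i) (H (orbit j₀))) (indicator d)
  order-on-orbit i j₀ j (yes i+j≡j₀) =
    order-simple-root (k ^ i) (orbit j) (orbit j₀) (ℕP.m^n>0 k ⦃ ℕ.>-nonZero (ℕP.≤-trans (s≤s z≤n) 2≤k) ⦄ i)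
      (trans (orbit-pw i j) (orbit-periodic (i ℕ.+ j) j₀ i+j≡j₀))
      (cast-pow-nonzero k i (cast-nonzero k 2≤k char)) (orbit-nonzero j)
  order-on-orbit i j₀ j (no i+j≢j₀) =
    order-non-root (k ^ i) (orbit j) (orbit j₀)
      (λ eq → i+j≢j₀ (orbit-injective (i ℕ.+ j) j₀ (trans (sym (orbit-pw i j)) eq)))

lemma10 : ∀ {c ℓ} (K : CommutativeRing c ℓ) → IsField K → IsAlgClosed K →
          (k : ℕ) → 2 ≤ k → CharAdmissible K k →
          (α : CommutativeRing.Carrier K) → KAnxious K k α →
          (m : ℕ) .{{_ : NonZero m}} → IsLeastReturn K k α m →
          (n : ℕ) (cs : Fin n → Frac K) → (∀ ι → IsRatFun K (cs ι)) →
          (j₀ j : ℕ) (ι : Fin n) (w : ℤ∞) →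
          Val K (pow K α (k ^ j)) (cs ι) w →
          Val K (pow K α (k ^ j))
                (pullback K k (hpoly K (pow K α (k ^ j₀))) (suc (toℕ ι)) (cs ι))
                (w +∞ δ m (suc (toℕ ι)) j j₀)
lemma10 K F _ k 2≤k char α anxious m least-return n cs _ j₀ j ι w v =
  Eq.subst (Val K γ (pullback K k (H β) i (cs ι))) (Eq.cong (w +∞_) (Eq.sym (δ-as-difference m i j j₀)))
    (pullback-valuation k i γ β (cs ι) e-num e-den numerator-order denominator-order v)
  where
  open LinearFactors K using (H; expand-one)
  open VanishingOrder K F using (pullback-valuation; OrdFin-cong)
  open FrobeniusOrbit K k α anxious m least-return using (orbit)
  open OrbitVanishing K F k 2≤k char α anxious m least-return using (order-on-orbit)
  i : ℕ
  i = suc (toℕ ι)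
  γ β : CommutativeRing.Carrier K
  γ = orbit j
  β = orbit j₀
  e-num e-den : ℕ
  e-num = indicator ((i ℕ.+ j) % m ≟ j₀ % m)
  e-den = indicator (j % m ≟ j₀ % m)
  numerator-order : OrdFin K γ (expand K (k ^ i) (H β)) e-num
  numerator-order = order-on-orbit i j₀ j ((i ℕ.+ j) % m ≟ j₀ % m)
  denominator-order : OrdFin K γ (H β) e-den
  denominator-order = OrdFin-cong {e = e-den} (expand-one (H β)) (order-on-orbit 0 j₀ j (j % m ≟ j₀ % m))
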